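{- Let $P$ be a poset, $e_X:P\to X$ and $e_Y:P\to Y$ order embeddings into disjoint posets, $R_l\subseteq X\times Y$ given by $x\mathrel{R_l}y\iff e_X^{ -1}(x^\uparrow)\cap e_Y^{ -1}(y^\downarrow)\neq\emptyset$, and suppose $G=(e_X,e_Y,R_l)$ is a Galois polarity with unique 3-preorder $\preceq$. Let $Q$ be a poset and $f:X\to Q$, $g:Y\to Q$ order preserving maps with $f\circ e_X=g\circ e_Y$. The following are equivalent: (1) for all $x\in X$ and $y\in Y$, $y\preceq x$ implies $g(y)\le f(x)$; (2) there is a unique order preserving map $u:X\uplus Y\to Q$ with $u\circ\iota_X=f$ and $u\circ\iota_Y=g$.
   Context: For a poset $Q$, $q^\uparrow=\{r:r\ge q\}$, $q^\downarrow=\{r:r\le q\}$. An order embedding $e:P\to Q$ is a meet-extension if $q=\bigwedge e[e^{ -1}(q^\uparrow)]$ for all $q$, a join-extension if $q=\bigvee e[e^{ -1}(q^\downarrow)]$ for all $q$. An extension polarity $(e_X,e_Y,R)$ (with $R\subseteq X\times Y$) is 3-coherent if (variables over $X,Y,P$): (C1) $x_1\le_X x_2$, $x_2\mathrel{R}y$ imply $x_1\mathrel{R}y$; (C2) $y_1\le_Y y_2$, $x\mathrel{R}y_1$ imply $x\mathrel{R}y_2$; (C3) $e_X(p)\mathrel{R}e_Y(p)$; (C4) $x\mathrel{R}e_Y(p)$, $e_X(p)\mathrel{R}y$ imply $x\mathrel{R}y$; (C5) $x_1\mathrel{R}e_Y(p)$, $e_X(p)\le_X x_2$ imply $x_1\le_X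 x_2$; (C6) $y_1\le_Y e_Y(p)$, $e_X(p)\mathrel{R}y_2$ imply $y_1\le_Y y_2$; (C7) if $S\subseteq P$, $\bigwedge e_X[S]=x$ in $X$, $x\mathrel{R}y_2$, $y_1\le_Y e_Y(p)$ for all $p\in S$, then $y_1\le_Y y_2$; (C8) if $T\subseteq P$, $\bigvee e_Y[T]=y$ in $Y$, $x_1\mathrel{R}y$, $e_X(q)\le_X x_2$ for all $q\in T$, then $x_1\le_X x_2$. A Galois polarity is a 3-coherent one with $e_X$ a meet-extension and $e_Y$ a join-extension. A 3-preorder is a preorder $\preceq$ on $X\cup Y$ such that, with $X\uplus Y$ the quotient poset (identify $z_1,z_2$ when $z_1\preceq z_2\preceq z_1$) and $\iota_X,\iota_Y$ the inclusions followed by quotient: $x\preceq y\iff x\mathrel{R}y$ for $x\in X,y\in Y$; ${\le_X},{\le_Y}\subseteq{\preceq}$; $\iota_X\circ e_X=\iota_Y\circ e_Y$; $\iota_X,\iota_Y$ are order embeddings; $\iota_X$ preserves all meets of subsets of $e_X[P]$ existing in $X$ and $\iota_Y$ preserves all joins of subsets of $e_Y[P]$ existing in $Y$. A Galois polarity has exactly one 3-preorder. -}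

module Defs where

open import Level using (0ℓ)
open import Data.Product using (Σ; ∃; _×_; _,_)
open import Data.Sum using (_⊎_; inj₁; inj₂)
open import Relation.Unary using (Pred)
open import Relation.Binary.Bundles using (Poset)
open import Function.Bundles using (_⇔_)

Pos : Set₁
Pos = Poset 0ℓ 0ℓ 0ℓ

module _ {P X : Pos} where
  private
    module P = Poset P
    module X = Poset X

  IsOrderEmbedding : (P.Carrier → X.Carrier) → Set
  IsOrderEmbedding e = ∀ p q → (p P.≤ q) ⇔ (e p X.≤ e q)

IsMonotone : (A B : Pos) → (Poset.Carrier A → Poset.Carrier B) → Set
IsMonotone A B f = ∀ {a b} → Poset._≤_ A a b → Poset._≤_ B (f a) (f b)

IsMeetOfImage : (X : Pos) {I : Set} → (I → Poset.Carrier X) → Pred I 0ℓ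
              → Poset.Carrier X → Set
IsMeetOfImage X e S z =
  (∀ p → S p → z ≤ e p) × (∀ w → (∀ p → S p → w ≤ e p) → w ≤ z)
  where open Poset X

IsJoinOfImage : (Y : Pos) {I : Set} → (I → Poset.Carrier Y) → Pred I 0ℓ
              → Poset.Carrier Y → Set
IsJoinOfImage Y e T z =
  (∀ p → T p → e p ≤ z) × (∀ w → (∀ p → T p → e p ≤ w) → z ≤ w)
  where open Poset Y

IsMeetExtension : (P X : Pos) → (Poset.Carrier P → Poset.Carrier X) → Set
IsMeetExtension P X e =
  IsOrderEmbedding {P} {X} e ×
  (∀ q → IsMeetOfImage X e (λ p → Poset._≤_ X q (e p)) q)

IsJoinExtension : (P Y : Pos) → (Poset.Carrier P → Poset.Carrier Y) → Set
IsJoinExtension P Y e =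
  IsOrderEmbedding {P} {Y} e ×
  (∀ q → IsJoinOfImage Y e (λ p → Poset._≤_ Y (e p) q) q)

module Polarity (P X Y : Pos)
  (eX : Poset.Carrier P → Poset.Carrier X)
  (eY : Poset.Carrier P → Poset.Carrier Y)
  (R : Poset.Carrier X → Poset.Carrier Y → Set) where

  private
    module P = Poset P
    module X = Poset X
    module Y = Poset Y

  record Is3Coherent : Set₁ where
    field
      C1 : ∀ {x₁ x₂ y} → x₁ X.≤ x₂ → R x₂ y → R x₁ y
      C2 : ∀ {y₁ y₂ x} → y₁ Y.≤ y₂ → R x y₁ → R x y₂
      C3 : ∀ p → R (eX p) (eY p)
      C4 : ∀ {x y p} → R x (eY p) → R (eX p) y → R x y
      C5 : ∀ {x₁ x₂ p} → R x₁ (eY p) → eX p X.≤ x₂ → x₁ X.≤ x₂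
      C6 : ∀ {y₁ y₂ p} → y₁ Y.≤ eY p → R (eX p) y₂ → y₁ Y.≤ y₂
      C7 : ∀ (S : Pred P.Carrier 0ℓ) {x y₁ y₂} → IsMeetOfImage X eX S x
           → R x y₂ → (∀ p → S p → y₁ Y.≤ eY p) → y₁ Y.≤ y₂
      C8 : ∀ (T : Pred P.Carrier 0ℓ) {y x₁ x₂} → IsJoinOfImage Y eY T y
           → R x₁ y → (∀ q → T q → eX q X.≤ x₂) → x₁ X.≤ x₂

  IsGaloisPolarity : Set₁
  IsGaloisPolarity = Is3Coherent × IsMeetExtension P X eX × IsJoinExtension P Y eY

  Z : Set
  Z = X.Carrier ⊎ Y.Carrier

  IsMeetIn : (Z → Z → Set) → {I : Set} → (I → Z) → Pred I 0ℓ → Z → Set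
  IsMeetIn _≼_ h S z =
    (∀ p → S p → z ≼ h p) × (∀ w → (∀ p → S p → w ≼ h p) → w ≼ z)

  IsJoinIn : (Z → Z → Set) → {I : Set} → (I → Z) → Pred I 0ℓ → Z → Set
  IsJoinIn _≼_ h T z =
    (∀ p → T p → h p ≼ z) × (∀ w → (∀ p → T p → h p ≼ w) → z ≼ w)

  -- A 3-preorder.  The quotient poset X ⊎ Y is represented by the preorder
  -- itself: [z₁] ≤ [z₂] iff z₁ ≼ z₂, and [z₁] = [z₂] iff z₁ ≼ z₂ ≼ z₁.
  record Is3Preorder (_≼_ : Z → Z → Set) : Set₁ where
    field
      refl≼  : ∀ z → z ≼ z
      trans≼ : ∀ {a b c} → a ≼ b → b ≼ c → a ≼ c
      xy⇔R   : ∀ x y → (inj₁ x ≼ inj₂ y) ⇔ R x y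
      ≤X⊆≼   : ∀ {x₁ x₂} → x₁ X.≤ x₂ → inj₁ x₁ ≼ inj₁ x₂
      ≤Y⊆≼   : ∀ {y₁ y₂} → y₁ Y.≤ y₂ → inj₂ y₁ ≼ inj₂ y₂
      -- ι_X ∘ e_X = ι_Y ∘ e_Y in the quotient
      eXeY   : ∀ p → inj₁ (eX p) ≼ inj₂ (eY p)
      eYeX   : ∀ p → inj₂ (eY p) ≼ inj₁ (eX p)
      -- ι_X, ι_Y are order embeddings (the other direction is ≤X⊆≼, ≤Y⊆≼)
      ιX-refl : ∀ {x₁ x₂} → inj₁ x₁ ≼ inj₁ x₂ → x₁ X.≤ x₂
      ιY-refl : ∀ {y₁ y₂} → inj₂ y₁ ≼ inj₂ y₂ → y₁ Y.≤ y₂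
      ιX-meets : ∀ (S : Pred P.Carrier 0ℓ) x → IsMeetOfImage X eX S x
                 → IsMeetIn _≼_ (λ p → inj₁ (eX p)) S (inj₁ x)
      ιY-joins : ∀ (T : Pred P.Carrier 0ℓ) y → IsJoinOfImage Y eY T y
                 → IsJoinIn _≼_ (λ p → inj₂ (eY p)) T (inj₂ y)

Rl : (P X Y : Pos) → (Poset.Carrier P → Poset.Carrier X)
   → (Poset.Carrier P → Poset.Carrier Y)
   → Poset.Carrier X → Poset.Carrier Y → Set
Rl P X Y eX eY x y =
  ∃ λ p → Poset._≤_ X x (eX p) × Poset._≤_ Y (eY p) y

-- The copairing [ f , g ] is the only candidate for u, so uniqueness is automatic and
-- (2) ⇒ (1) is monotonicity of u on y ≼ x. For (1) ⇒ (2): ι_X and ι_Y reflect the order;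
-- x ≼ y means x ≤ e_X p and e_Y p ≤ y for some p, whence f x ≤ f (e_X p) ≈ g (e_Y p) ≤ g y;
-- and y ≼ x is hypothesis (1). The Galois hypotheses only serve to make the 3-preorder exist.
module Submission where

open import Defs
open import Data.Product using (Σ; _×_; _,_)
open import Data.Sum using (_⊎_; inj₁; inj₂; [_,_])
open import Relation.Binary.Bundles using (Poset)
open import Function.Bundles using (_⇔_; mk⇔; Equivalence)
import Relation.Binary.Reasoning.PartialOrder as PosetReasoning

module Extensions {A B : Set} (Q : Pos) (_≼_ : A ⊎ B → A ⊎ B → Set)
  (f : A → Poset.Carrier Q) (g : B → Poset.Carrier Q) where

  open Poset Q
  open PosetReasoning Q

  Monotone≼ : (A ⊎ B → Carrier) → Set
  Monotone≼ u = ∀ {z₁ z₂} → z₁ ≼ z₂ → u z₁ ≤ u z₂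

  Extends : (A ⊎ B → Carrier) → Set
  Extends u = (∀ x → u (inj₁ x) ≈ f x) × (∀ y → u (inj₂ y) ≈ g y)

  extends-copair : Extends [ f , g ]
  extends-copair = (λ _ → Eq.refl) , (λ _ → Eq.refl)

  extension-unique : ∀ {u v} → Extends u → Extends v → ∀ z → v z ≈ u z
  extension-unique (uf , ug) (vf , vg) (inj₁ x) = Eq.trans (vf x) (Eq.sym (uf x))
  extension-unique (uf , ug) (vf , vg) (inj₂ y) = Eq.trans (vg y) (Eq.sym (ug y))

  monotone-extension-respects-≼ : ∀ {u} → Monotone≼ u → Extends u →
                                  ∀ x y → inj₂ y ≼ inj₁ x → g y ≤ f x
  monotone-extension-respects-≼ {u} mono (uf , ug) x y y≼x = begin
    g y         ≈⟨ Eq.sym (ug y) ⟩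
    u (inj₂ y)  ≤⟨ mono y≼x ⟩
    u (inj₁ x)  ≈⟨ uf x ⟩
    f x         ∎

module _ (P X Y Q : Pos)
  (eX : Poset.Carrier P → Poset.Carrier X)
  (eY : Poset.Carrier P → Poset.Carrier Y)
  {f : Poset.Carrier X → Poset.Carrier Q}
  {g : Poset.Carrier Y → Poset.Carrier Q}
  (f-mono : IsMonotone X Q f) (g-mono : IsMonotone Y Q g)
  (f∘eX≈g∘eY : ∀ p → Poset._≈_ Q (f (eX p)) (g (eY p))) where

  open Poset Q
  open PosetReasoning Q

  Rl⇒≤ : ∀ {x y} → Rl P X Y eX eY x y → f x ≤ g y
  Rl⇒≤ {x} {y} (p , x≤eXp , eYp≤y) = begin
    f x       ≤⟨ f-mono x≤eXp ⟩
    f (eX p)  ≈⟨ f∘eX≈g∘eY p ⟩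
    g (eY p)  ≤⟨ g-mono eYp≤y ⟩
    g y       ∎

  module _ {_≼_ : Polarity.Z P X Y eX eY (Rl P X Y eX eY)
                → Polarity.Z P X Y eX eY (Rl P X Y eX eY) → Set}
    (pre : Polarity.Is3Preorder P X Y eX eY (Rl P X Y eX eY) _≼_) where

    open Polarity.Is3Preorder pre
    open Extensions Q _≼_ f g

    copair-monotone : (∀ x y → inj₂ y ≼ inj₁ x → g y ≤ f x) → Monotone≼ [ f , g ]
    copair-monotone y≼x⇒≤ {inj₁ x₁} {inj₁ x₂} x₁≼x₂ = f-mono (ιX-refl x₁≼x₂)
    copair-monotone y≼x⇒≤ {inj₂ y₁} {inj₂ y₂} y₁≼y₂ = g-mono (ιY-refl y₁≼y₂)
    copair-monotone y≼x⇒≤ {inj₁ x}  {inj₂ y}  x≼y   = Rl⇒≤ (Equivalence.to (xy⇔R x y) x≼y)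
    copair-monotone y≼x⇒≤ {inj₂ y}  {inj₁ x}  y≼x   = y≼x⇒≤ x y y≼x

proposition7p30 :
    (P X Y : Pos)
    (eX : Poset.Carrier P → Poset.Carrier X)
    (eY : Poset.Carrier P → Poset.Carrier Y) →
    IsOrderEmbedding {P} {X} eX → IsOrderEmbedding {P} {Y} eY →
    Polarity.IsGaloisPolarity P X Y eX eY (Rl P X Y eX eY) →
    (_≼_ : Polarity.Z P X Y eX eY (Rl P X Y eX eY) → Polarity.Z P X Y eX eY (Rl P X Y eX eY) → Set) →
    Polarity.Is3Preorder P X Y eX eY (Rl P X Y eX eY) _≼_ →
    (Q : Pos)
    (f : Poset.Carrier X → Poset.Carrier Q)
    (g : Poset.Carrier Y → Poset.Carrier Q) →
    IsMonotone X Q f → IsMonotone Y Q g →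
    (∀ p → Poset._≈_ Q (f (eX p)) (g (eY p))) →
    (∀ x y → inj₂ y ≼ inj₁ x → Poset._≤_ Q (g y) (f x))
    ⇔
    (Σ (Polarity.Z P X Y eX eY (Rl P X Y eX eY) → Poset.Carrier Q) λ u →
      ((∀ {z₁ z₂} → z₁ ≼ z₂ → Poset._≤_ Q (u z₁) (u z₂))
       × (∀ x → Poset._≈_ Q (u (inj₁ x)) (f x))
       × (∀ y → Poset._≈_ Q (u (inj₂ y)) (g y)))
      × (∀ (v : Polarity.Z P X Y eX eY (Rl P X Y eX eY) → Poset.Carrier Q) →
           (∀ {z₁ z₂} → z₁ ≼ z₂ → Poset._≤_ Q (v z₁) (v z₂)) →
           (∀ x → Poset._≈_ Q (v (inj₁ x)) (f x)) →
           (∀ y → Poset._≈_ Q (v (inj₂ y)) (g y)) →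
           ∀ z → Poset._≈_ Q (v z) (u z)))
proposition7p30 P X Y eX eY _ _ _ _≼_ pre Q f g f-mono g-mono f∘eX≈g∘eY = mk⇔
  (λ y≼x⇒≤ →
    [ f , g ] ,
    ((λ {z₁ z₂} → copair-monotone P X Y Q eX eY f-mono g-mono f∘eX≈g∘eY pre y≼x⇒≤ {z₁} {z₂}) ,
     extends-copair) ,
    λ v _ vf vg → extension-unique extends-copair (vf , vg))
  (λ (u , (u-mono , uf , ug) , _) → monotone-extension-respects-≼ u-mono (uf , ug))
  where open Extensions Q _≼_ f g
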